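{- For every positive integer $n$ there exists a binary linear code of length $8n$, dimension $\lfloor(6\log_2 3-8)n\rfloor$ and minimum distance $2n$.
   Context: A binary linear code of length $N$, dimension $k$ and minimum distance $d$ is a $k$-dimensional subspace of ${\bf F}_2^N$ whose minimum nonzero Hamming weight is $d$. -}

module Defs where

open import Data.Bool using (Bool; true; false; _xor_; if_then_else_)
open import Data.Nat using (ℕ; zero; suc; _+_; _*_; _^_; _≤_; _<_)
open import Data.Vec using (Vec; []; _∷_; replicate; zipWith)
open import Data.Product using (Σ; ∃; _×_)
open import Relation.Binary.PropositionalEquality using (_≡_; _≢_)

-- Vectors of F_2^N are Vec Bool N (false = 0, true = 1, xor = addition).

zeroVec : (N : ℕ) → Vec Bool N
zeroVec N = replicate N false

_⊕_ : ∀ {N} → Vec Bool N → Vec Bool N → Vec Bool N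
_⊕_ = zipWith _xor_

weight : ∀ {N} → Vec Bool N → ℕ
weight [] = 0
weight (true ∷ v) = suc (weight v)
weight (false ∷ v) = weight v

encode : ∀ {N k} → Vec (Vec Bool N) k → Vec Bool k → Vec Bool N
encode {N} [] [] = zeroVec N
encode (g ∷ gs) (b ∷ bs) = (if b then g else zeroVec _) ⊕ encode gs bs

-- A binary linear [N, k, d] code: a k-dimensional subspace C of F_2^N,
-- presented as the span of k linearly independent vectors g_1..g_k
-- (the rows of G), whose minimum nonzero Hamming weight is exactly d.
BinaryLinearCode : (N k d : ℕ) → Set
BinaryLinearCode N k d =
  Σ (Vec (Vec Bool N) k) λ G →
    -- the rows are linearly independent, so the span has dimension k
    ((m : Vec Bool k) → m ≢ zeroVec k → encode G m ≢ zeroVec N)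
  × ((m : Vec Bool k) → encode G m ≢ zeroVec N → d ≤ weight (encode G m))
  × (∃ λ (m : Vec Bool k) → encode G m ≢ zeroVec N × weight (encode G m) ≡ d)

-- k = ⌊(6 log₂ 3 − 8) n⌋, unfolded: k is the integer with
--   k ≤ (6 log₂ 3 − 8) n < k + 1,
-- i.e. (exponentiating base 2)  2^(k + 8n) ≤ 3^(6n) < 2^(k + 1 + 8n).
IsFloor6log3minus8 : (n k : ℕ) → Set
IsFloor6log3minus8 n k =
  (2 ^ (k + 8 * n) ≤ 3 ^ (6 * n)) × (3 ^ (6 * n) < 2 ^ (suc k + 8 * n))

{-# OPTIONS --safe #-}
-- Gilbert–Varshamov by greedy extension. Let V be the number of vectors of
-- weight < 2n in F₂^(8n). While 2^j · V < 2^(8n), the 2^j translates by the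
-- span of the rows chosen so far of the ball of radius < 2n cannot cover
-- F₂^(8n), so a new row at distance ≥ 2n from the whole span exists; starting
-- from a row of weight exactly 2n makes the minimum distance exactly 2n.
-- The volume is bounded by weighting each vector with 3^(number of zeros):
-- these weights sum to 4^(8n), and every vector of the ball has ≥ 6n zeros,
-- so V · 3^(6n) ≤ 2^(16n), which together with 2^(k + 8n) ≤ 3^(6n) gives
-- 2^k · V ≤ 2^(8n).
module Submission where

open import Defs
open import Data.Nat using (ℕ; zero; suc; _+_; _*_; _^_; _≤_; _<_; _<ᵇ_; z≤n; s≤s; z<s)
open import Data.Nat.Properties
open import Algebra.Properties.CommutativeSemigroup +-commutativeSemigroup using (interchange)
open import Data.Bool using (Bool; true; false; _∨_; T)
open import Data.Unit using (tt)
open import Data.Vec using (Vec; []; _∷_)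
open import Data.Product using (Σ; ∃; _×_; _,_)
open import Data.Empty using (⊥-elim)
open import Relation.Nullary using (yes; no)
open import Relation.Binary.PropositionalEquality

∑ : ∀ {N} → (Vec Bool N → ℕ) → ℕ
∑ {zero} f = f []
∑ {suc N} f = ∑ (λ v → f (false ∷ v)) + ∑ (λ v → f (true ∷ v))

∑-mono-≤ : ∀ {N} {f g : Vec Bool N → ℕ} → (∀ v → f v ≤ g v) → ∑ f ≤ ∑ g
∑-mono-≤ {zero} f≤g = f≤g []
∑-mono-≤ {suc N} f≤g = +-mono-≤ (∑-mono-≤ (λ v → f≤g (false ∷ v))) (∑-mono-≤ (λ v → f≤g (true ∷ v)))

∑-distrib-+ : ∀ {N} (f g : Vec Bool N → ℕ) → ∑ (λ v → f v + g v) ≡ ∑ f + ∑ g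
∑-distrib-+ {zero} f g = refl
∑-distrib-+ {suc N} f g
  rewrite ∑-distrib-+ (λ v → f (false ∷ v)) (λ v → g (false ∷ v))
        | ∑-distrib-+ (λ v → f (true ∷ v)) (λ v → g (true ∷ v))
  = interchange (∑ (λ v → f (false ∷ v))) (∑ (λ v → g (false ∷ v)))
                (∑ (λ v → f (true ∷ v))) (∑ (λ v → g (true ∷ v)))

∑-distribˡ-* : ∀ {N} (c : ℕ) (f : Vec Bool N → ℕ) → ∑ (λ v → c * f v) ≡ c * ∑ f
∑-distribˡ-* {zero} c f = refl
∑-distribˡ-* {suc N} c f
  rewrite ∑-distribˡ-* c (λ v → f (false ∷ v)) | ∑-distribˡ-* c (λ v → f (true ∷ v))
  = sym (*-distribˡ-+ c _ _)

∑-cong : ∀ {N} {f g : Vec Bool N → ℕ} → (∀ v → f v ≡ g v) → ∑ f ≡ ∑ g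
∑-cong {zero} f≗g = f≗g []
∑-cong {suc N} f≗g = cong₂ _+_ (∑-cong (λ v → f≗g (false ∷ v))) (∑-cong (λ v → f≗g (true ∷ v)))

∑-const : ∀ {N} (c : ℕ) → ∑ {N} (λ _ → c) ≡ 2 ^ N * c
∑-const {zero} c = sym (+-identityʳ c)
∑-const {suc N} c = begin
  ∑ {N} (λ _ → c) + ∑ {N} (λ _ → c)  ≡⟨ cong (λ s → s + s) (∑-const {N} c) ⟩
  2 ^ N * c + 2 ^ N * c              ≡⟨ cong (2 ^ N * c +_) (sym (+-identityʳ (2 ^ N * c))) ⟩
  2 * (2 ^ N * c)                    ≡⟨ sym (*-assoc 2 (2 ^ N) c) ⟩
  2 ^ suc N * c                      ∎
  where open ≡-Reasoning

∑-translate : ∀ {N} (f : Vec Bool N → ℕ) (c : Vec Bool N) → ∑ (λ x → f (x ⊕ c)) ≡ ∑ f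
∑-translate {zero} f [] = refl
∑-translate {suc N} f (false ∷ c) =
  cong₂ _+_ (∑-translate (λ v → f (false ∷ v)) c) (∑-translate (λ v → f (true ∷ v)) c)
∑-translate {suc N} f (true ∷ c) =
  trans (cong₂ _+_ (∑-translate (λ v → f (true ∷ v)) c) (∑-translate (λ v → f (false ∷ v)) c))
        (+-comm (∑ (λ v → f (true ∷ v))) (∑ (λ v → f (false ∷ v))))

indicator : Bool → ℕ
indicator true = 1
indicator false = 0

indicator-∨ : ∀ a b → indicator (a ∨ b) ≤ indicator a + indicator b
indicator-∨ false b = ≤-refl
indicator-∨ true false = ≤-refl
indicator-∨ true true = s≤s z≤n

count : ∀ {N} → (Vec Bool N → Bool) → ℕ
count p = ∑ (λ v → indicator (p v))

count<2^⇒∃false : ∀ {N} (p : Vec Bool N → Bool) → count p < 2 ^ N → ∃ λ v → p v ≡ false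
count<2^⇒∃false {zero} p count<1 with p [] in eq
... | false = [] , eq
... | true = ⊥-elim (<-irrefl refl count<1)
count<2^⇒∃false {suc N} p count<2^[1+N] with count (λ v → p (false ∷ v)) <? 2 ^ N
... | yes lt = let v , eq = count<2^⇒∃false (λ v → p (false ∷ v)) lt in false ∷ v , eq
... | no ≮ = let v , eq = count<2^⇒∃false (λ v → p (true ∷ v)) lt in true ∷ v , eq
  where
  lt : count (λ v → p (true ∷ v)) < 2 ^ N
  lt = +-cancelˡ-< (2 ^ N) _ _
         (≤-<-trans (+-monoˡ-≤ _ (≮⇒≥ ≮))
           (subst (count p <_) (cong (2 ^ N +_) (+-identityʳ (2 ^ N))) count<2^[1+N]))

anyᵛ : ∀ {N} → (Vec Bool N → Bool) → Bool
anyᵛ {zero} p = p []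
anyᵛ {suc N} p = anyᵛ (λ v → p (false ∷ v)) ∨ anyᵛ (λ v → p (true ∷ v))

anyᵛ-false : ∀ {N} (p : Vec Bool N → Bool) → anyᵛ p ≡ false → ∀ m → p m ≡ false
anyᵛ-false {zero} p none [] = none
anyᵛ-false {suc N} p none (b ∷ m) with anyᵛ (λ v → p (false ∷ v)) in eq
anyᵛ-false {suc N} p none (false ∷ m) | false = anyᵛ-false _ eq m
anyᵛ-false {suc N} p none (true ∷ m)  | false = anyᵛ-false _ none m
anyᵛ-false {suc N} p () (b ∷ m)        | true

count-anyᵛ≤∑count : ∀ {N j} (q : Vec Bool N → Vec Bool j → Bool) →
  count (λ x → anyᵛ (q x)) ≤ ∑ (λ m → count (λ x → q x m))
count-anyᵛ≤∑count {N} {zero} q = ≤-refl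
count-anyᵛ≤∑count {N} {suc j} q = begin
  count (λ x → anyᵛ (q x))
    ≤⟨ ∑-mono-≤ (λ x → indicator-∨ (anyᵛ (q₀ x)) (anyᵛ (q₁ x))) ⟩
  ∑ (λ x → indicator (anyᵛ (q₀ x)) + indicator (anyᵛ (q₁ x)))
    ≡⟨ ∑-distrib-+ (λ x → indicator (anyᵛ (q₀ x))) (λ x → indicator (anyᵛ (q₁ x))) ⟩
  count (λ x → anyᵛ (q₀ x)) + count (λ x → anyᵛ (q₁ x))
    ≤⟨ +-mono-≤ (count-anyᵛ≤∑count q₀) (count-anyᵛ≤∑count q₁) ⟩
  ∑ (λ m → count (λ x → q₀ x m)) + ∑ (λ m → count (λ x → q₁ x m))
    ∎
  where
  open ≤-Reasoning
  q₀ q₁ : Vec Bool N → Vec Bool j → Bool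
  q₀ x m = q x (false ∷ m)
  q₁ x m = q x (true ∷ m)

⊕-identityˡ : ∀ {N} (v : Vec Bool N) → zeroVec N ⊕ v ≡ v
⊕-identityˡ [] = refl
⊕-identityˡ (b ∷ v) = cong (b ∷_) (⊕-identityˡ v)

⊕-identityʳ : ∀ {N} (v : Vec Bool N) → v ⊕ zeroVec N ≡ v
⊕-identityʳ [] = refl
⊕-identityʳ (false ∷ v) = cong (false ∷_) (⊕-identityʳ v)
⊕-identityʳ (true ∷ v) = cong (true ∷_) (⊕-identityʳ v)

weight-zeroVec : ∀ N → weight (zeroVec N) ≡ 0
weight-zeroVec zero = refl
weight-zeroVec (suc N) = weight-zeroVec N

encode-zeroVec : ∀ {N k} (G : Vec (Vec Bool N) k) → encode G (zeroVec k) ≡ zeroVec N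
encode-zeroVec [] = refl
encode-zeroVec (g ∷ G) = trans (⊕-identityˡ _) (encode-zeroVec G)

∃-weight≡ : ∀ N d → d ≤ N → ∃ λ (v : Vec Bool N) → weight v ≡ d
∃-weight≡ N zero _ = zeroVec N , weight-zeroVec N
∃-weight≡ (suc N) (suc d) (s≤s d≤N) =
  let v , weight≡d = ∃-weight≡ N d d≤N in true ∷ v , cong suc weight≡d

zeros : ∀ {N} → Vec Bool N → ℕ
zeros [] = 0
zeros (true ∷ v) = zeros v
zeros (false ∷ v) = suc (zeros v)

weight+zeros≡length : ∀ {N} (v : Vec Bool N) → weight v + zeros v ≡ N
weight+zeros≡length [] = refl
weight+zeros≡length (true ∷ v) = cong suc (weight+zeros≡length v)
weight+zeros≡length (false ∷ v) = trans (+-suc (weight v) (zeros v)) (cong suc (weight+zeros≡length v))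

∑-3^zeros : ∀ N → ∑ {N} (λ v → 3 ^ zeros v) ≡ 4 ^ N
∑-3^zeros zero = refl
∑-3^zeros (suc N) = begin
  ∑ {N} (λ v → 3 * 3 ^ zeros v) + S ≡⟨ cong (_+ S) (∑-distribˡ-* {N} 3 (λ v → 3 ^ zeros v)) ⟩
  3 * S + S                         ≡⟨ cong (λ s → 3 * s + s) (∑-3^zeros N) ⟩
  3 * 4 ^ N + 4 ^ N                 ≡⟨ +-comm (3 * 4 ^ N) (4 ^ N) ⟩
  4 ^ suc N                         ∎
  where
  open ≡-Reasoning
  S = ∑ {N} (λ v → 3 ^ zeros v)

ballVolume : ℕ → ℕ → ℕ
ballVolume N r = count {N} (λ v → weight v <ᵇ r)

ballVolume*3^≤4^ : ∀ N r c → r + c ≤ N → ballVolume N r * 3 ^ c ≤ 4 ^ N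
ballVolume*3^≤4^ N r c r+c≤N = begin
  ballVolume N r * 3 ^ c                          ≡⟨ *-comm (ballVolume N r) (3 ^ c) ⟩
  3 ^ c * ballVolume N r                          ≡⟨ ∑-distribˡ-* (3 ^ c) inBall ⟨
  ∑ {N} (λ v → 3 ^ c * inBall v)                  ≤⟨ ∑-mono-≤ pointwise ⟩
  ∑ {N} (λ v → 3 ^ zeros v)                       ≡⟨ ∑-3^zeros N ⟩
  4 ^ N                                           ∎
  where
  open ≤-Reasoning
  inBall : Vec Bool N → ℕ
  inBall v = indicator (weight v <ᵇ r)
  c≤zeros : ∀ (v : Vec Bool N) → weight v < r → c ≤ zeros v
  c≤zeros v w<r = ≮⇒≥ λ zeros<c →
    <-irrefl refl (≤-<-trans (≤-reflexive (sym (weight+zeros≡length v)))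
                    (<-≤-trans (+-mono-< w<r zeros<c) r+c≤N))
  pointwise : ∀ v → 3 ^ c * inBall v ≤ 3 ^ zeros v
  pointwise v with weight v <ᵇ r in eq
  ... | false = subst (_≤ 3 ^ zeros v) (sym (*-zeroʳ (3 ^ c))) z≤n
  ... | true = subst (_≤ 3 ^ zeros v) (sym (*-identityʳ (3 ^ c)))
                 (^-monoʳ-≤ 3 (c≤zeros v (<ᵇ⇒< (weight v) r (subst T (sym eq) tt))))

2*m≤n⇒m<n : ∀ {m n} → 2 * m ≤ n → 0 < n → m < n
2*m≤n⇒m<n {zero} _ 0<n = 0<n
2*m≤n⇒m<n {suc m} {n} 2m≤n _ =
  <-≤-trans (m<m+n (suc m) z<s) (subst (_≤ n) (cong (suc m +_) (+-identityʳ (suc m))) 2m≤n)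

HasMinWeight : ℕ → ∀ {N k} → Vec (Vec Bool N) k → Set
HasMinWeight d {k = k} G = ∀ m → m ≢ zeroVec k → d ≤ weight (encode G m)

∃-far-from-span : ∀ {N j} d (G : Vec (Vec Bool N) j) → 2 ^ j * ballVolume N d < 2 ^ N →
  ∃ λ g → ∀ m → d ≤ weight (g ⊕ encode G m)
∃-far-from-span {N} {j} d G small =
  let g , nowhere-near = count<2^⇒∃false (λ x → anyᵛ (near x)) few-near
  in g , λ m → ≮⇒≥ λ w<d → subst T (anyᵛ-false (near g) nowhere-near m) (<⇒<ᵇ w<d)
  where
  near : Vec Bool N → Vec Bool j → Bool
  near x m = weight (x ⊕ encode G m) <ᵇ d
  translate-volume : ∀ m → count (λ x → near x m) ≡ ballVolume N d
  translate-volume m = ∑-translate (λ x → indicator (weight x <ᵇ d)) (encode G m)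
  few-near : count (λ x → anyᵛ (near x)) < 2 ^ N
  few-near = begin-strict
    count (λ x → anyᵛ (near x))      ≤⟨ count-anyᵛ≤∑count near ⟩
    ∑ (λ m → count (λ x → near x m)) ≡⟨ ∑-cong translate-volume ⟩
    ∑ {j} (λ _ → ballVolume N d)     ≡⟨ ∑-const {j} (ballVolume N d) ⟩
    2 ^ j * ballVolume N d           <⟨ small ⟩
    2 ^ N                            ∎
    where open ≤-Reasoning

∷-minWeight : ∀ {N k d} {g : Vec Bool N} {G : Vec (Vec Bool N) k} →
  (∀ m → d ≤ weight (g ⊕ encode G m)) → HasMinWeight d G → HasMinWeight d (g ∷ G)
∷-minWeight g-far G-minWeight (true ∷ m) _ = g-far m
∷-minWeight {d = d} {G = G} g-far G-minWeight (false ∷ m) m≢0 =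
  subst (λ c → d ≤ weight c) (sym (⊕-identityˡ (encode G m)))
    (G-minWeight m (λ m≡0 → m≢0 (cong (false ∷_) m≡0)))

module _ {N d : ℕ} (u : Vec Bool N) (weight-u : weight u ≡ d) where

  greedy : ∀ j → 2 ^ suc j * ballVolume N d ≤ 2 ^ N →
    Σ (Vec (Vec Bool N) (suc j)) λ G → HasMinWeight d G × ∃ λ m → encode G m ≡ u
  greedy zero _ = u ∷ [] , [u]-minWeight , true ∷ [] , ⊕-identityʳ u
    where
    [u]-minWeight : HasMinWeight d (u ∷ [])
    [u]-minWeight (true ∷ []) _ = ≤-reflexive (sym (trans (cong weight (⊕-identityʳ u)) weight-u))
    [u]-minWeight (false ∷ []) m≢0 = ⊥-elim (m≢0 refl)
  greedy (suc j) room =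
    let G , G-minWeight , m , Gm≡u = greedy j (<⇒≤ room<)
        g , g-far = ∃-far-from-span d G room<
    in g ∷ G , ∷-minWeight g-far G-minWeight , false ∷ m , trans (⊕-identityˡ (encode G m)) Gm≡u
    where
    V = ballVolume N d
    room< : 2 ^ suc j * V < 2 ^ N
    room< = 2*m≤n⇒m<n (subst (_≤ 2 ^ N) (*-assoc 2 (2 ^ suc j) V) room) (m^n>0 2 N)

1≤weight⇒≢zeroVec : ∀ {N} (v : Vec Bool N) → 1 ≤ weight v → v ≢ zeroVec N
1≤weight⇒≢zeroVec {N} v 1≤w v≡0 =
  <-irrefl refl (<-≤-trans 1≤w (≤-reflexive (trans (cong weight v≡0) (weight-zeroVec N))))

minWeight⇒code : ∀ {N k d} (G : Vec (Vec Bool N) k) → 1 ≤ d → HasMinWeight d G →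
  (∃ λ m → weight (encode G m) ≡ d) → BinaryLinearCode N k d
minWeight⇒code {d = d} G 1≤d minWeight (m , weight≡d) =
  G , independent , minDistance , m , 1≤weight⇒≢zeroVec _ (≤-trans 1≤d (≤-reflexive (sym weight≡d))) , weight≡d
  where
  independent : ∀ m → m ≢ zeroVec _ → encode G m ≢ zeroVec _
  independent m m≢0 = 1≤weight⇒≢zeroVec _ (≤-trans 1≤d (minWeight m m≢0))
  minDistance : ∀ m → encode G m ≢ zeroVec _ → d ≤ weight (encode G m)
  minDistance m c≢0 = minWeight m (λ m≡0 → c≢0 (trans (cong (encode G) m≡0) (encode-zeroVec G)))

gilbertVarshamov : ∀ N d k → 1 ≤ d → d ≤ N → 1 ≤ k → 2 ^ k * ballVolume N d ≤ 2 ^ N →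
  BinaryLinearCode N k d
gilbertVarshamov N d (suc j) 1≤d d≤N _ room
  with u , weight-u ← ∃-weight≡ N d d≤N
  with G , minWeight , m , Gm≡u ← greedy u weight-u j room
  = minWeight⇒code G 1≤d minWeight (m , trans (cong weight Gm≡u) weight-u)

4^n≡2^n*2^n : ∀ n → 4 ^ n ≡ 2 ^ n * 2 ^ n
4^n≡2^n*2^n n = begin
  (2 ^ 2) ^ n       ≡⟨ ^-*-assoc 2 2 n ⟩
  2 ^ (n + (n + 0)) ≡⟨ cong (λ m → 2 ^ (n + m)) (+-identityʳ n) ⟩
  2 ^ (n + n)       ≡⟨ ^-distribˡ-+-* 2 n n ⟩
  2 ^ n * 2 ^ n     ∎
  where open ≡-Reasoning

2^k*ballVolume≤2^N : ∀ N r c k → r + c ≤ N → 2 ^ (k + N) ≤ 3 ^ c → 2 ^ k * ballVolume N r ≤ 2 ^ N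
2^k*ballVolume≤2^N N r c k r+c≤N 2^[k+N]≤3^c =
  *-cancelʳ-≤ (2 ^ k * V) (2 ^ N) (2 ^ N) {{m^n≢0 2 N}} (begin
    2 ^ k * V * 2 ^ N   ≡⟨ *-assoc (2 ^ k) V (2 ^ N) ⟩
    2 ^ k * (V * 2 ^ N) ≡⟨ cong (2 ^ k *_) (*-comm V (2 ^ N)) ⟩
    2 ^ k * (2 ^ N * V) ≡⟨ *-assoc (2 ^ k) (2 ^ N) V ⟨
    2 ^ k * 2 ^ N * V   ≡⟨ cong (_* V) (^-distribˡ-+-* 2 k N) ⟨
    2 ^ (k + N) * V     ≤⟨ *-monoˡ-≤ V 2^[k+N]≤3^c ⟩
    3 ^ c * V           ≡⟨ *-comm (3 ^ c) V ⟩
    V * 3 ^ c           ≤⟨ ballVolume*3^≤4^ N r c r+c≤N ⟩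
    4 ^ N               ≡⟨ 4^n≡2^n*2^n N ⟩
    2 ^ N * 2 ^ N       ∎)
  where
  open ≤-Reasoning
  V = ballVolume N r

2^[1+8n]≤3^[6n] : ∀ n → 1 ≤ n → 2 ^ suc (8 * n) ≤ 3 ^ (6 * n)
2^[1+8n]≤3^[6n] (suc n) _ = begin
  2 * 2 ^ (8 * suc n)     ≡⟨ cong (2 *_) (^-*-assoc 2 8 (suc n)) ⟨
  2 * (256 * 256 ^ n)     ≡⟨ *-assoc 2 256 (256 ^ n) ⟨
  512 * 256 ^ n           ≤⟨ *-mono-≤ (≤ᵇ⇒≤ 512 729 tt) (^-monoˡ-≤ n (≤ᵇ⇒≤ 256 729 tt)) ⟩
  729 * 729 ^ n           ≡⟨ ^-*-assoc 3 6 (suc n) ⟩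
  3 ^ (6 * suc n)         ∎
  where open ≤-Reasoning

lemma6p2 : (n : ℕ) → 1 ≤ n → (k : ℕ) → IsFloor6log3minus8 n k →
    BinaryLinearCode (8 * n) k (2 * n)
lemma6p2 n 1≤n k (2^[k+8n]≤3^[6n] , 3^[6n]<2^[1+k+8n]) =
  gilbertVarshamov (8 * n) (2 * n) k 1≤2n 2n≤8n (1≤k k 3^[6n]<2^[1+k+8n])
    (2^k*ballVolume≤2^N (8 * n) (2 * n) (6 * n) k (≤-reflexive 2n+6n≡8n) 2^[k+8n]≤3^[6n])
  where
  2n+6n≡8n : 2 * n + 6 * n ≡ 8 * n
  2n+6n≡8n = sym (*-distribʳ-+ n 2 6)
  1≤2n : 1 ≤ 2 * n
  1≤2n = ≤-trans 1≤n (m≤m+n n (n + 0))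
  2n≤8n : 2 * n ≤ 8 * n
  2n≤8n = *-monoˡ-≤ n (≤ᵇ⇒≤ 2 8 tt)
  1≤k : ∀ k → 3 ^ (6 * n) < 2 ^ (suc k + 8 * n) → 1 ≤ k
  1≤k zero 3^[6n]<2^[1+8n] = ⊥-elim (<-irrefl refl (<-≤-trans 3^[6n]<2^[1+8n] (2^[1+8n]≤3^[6n] n 1≤n)))
  1≤k (suc k) _ = s≤s z≤n
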